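{- For every prime $p>3$, $$\sum_{k=0}^{p-1}(-1)^k\binom{k}{0}_2\equiv p\,\frac{3\left(\frac p3\right)-1}{2}\pmod{p^2},\qquad \sum_{k=0}^{p-1}(-1)^k\binom{k}{1}_2\equiv 1-p\,\frac{3\left(\frac p3\right)-1}{2}\pmod{p^2},$$ and $$\sum_{k=0}^{p-1}(-1)^k\binom{k}{2}_2\equiv -2+3p\left(\frac p3\right)\pmod{p^2}.$$
   Context: The trinomial coefficients $\binom{n}{k}_2$ are defined for integers $n\ge 0$ by $(1+x+x^{ -1})^n=\sum_{k=-n}^{n}\binom{n}{k}_2x^k$. $\left(\frac{p}{3}\right)$ is the Legendre symbol modulo $3$ (equal to $1$ if $p\equiv1\pmod 3$ and $-1$ if $p\equiv 2\pmod 3$). Congruences of rationals are understood modulo $p^2$ in the ring of rationals with denominator prime to $p$. -}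

module Defs where

open import Data.Nat as ℕ using (ℕ; zero; suc; _%_)
open import Data.Integer as ℤ using (ℤ; +_; _+_; _-_; _*_; -_; 0ℤ; 1ℤ)
open import Data.Integer.DivMod using (_/_)
open import Data.Integer.Divisibility using (_∣_)
open import Data.List using (List; foldr; map; upTo)

-- Trinomial coefficient (n choose k)_2 : the coefficient of x^k in (1 + x + x⁻¹)^n,
-- computed by the recursion coming from (1+x+x⁻¹)^(n+1) = (1+x+x⁻¹)^n (1+x+x⁻¹).
trinom : ℕ → ℤ → ℤ
trinom zero    (+ zero) = 1ℤ
trinom zero    _        = 0ℤ
trinom (suc n) k = trinom n (k - 1ℤ) + trinom n k + trinom n (k + 1ℤ)

-- Legendre symbol (p/3) for p not divisible by 3 (value 0 when 3 ∣ p).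
legendre3 : ℕ → ℤ
legendre3 p with p % 3
... | 0 = 0ℤ
... | 1 = 1ℤ
... | _ = - 1ℤ

_≡_[mod_] : ℤ → ℤ → ℤ → Set
a ≡ b [mod m ] = m ∣ (a - b)

sgn : ℕ → ℤ
sgn zero = 1ℤ
sgn (suc k) = - sgn k

altSum : ℕ → ℤ → ℤ
altSum p j = foldr _+_ 0ℤ (map (λ k → sgn k * trinom k j) (upTo p))

-- Write Tₙ(k) for the trinomial coefficients, Sⱼ for the alternating sums, and n = p - 1.
-- Since Tₖ₊₁(0) = Tₖ(0) + 2Tₖ(1) and Tₖ₊₁(1) = Tₖ(0) + Tₖ(1) + Tₖ(2), alternating sums
-- telescope: 2S₀ + 2S₁ = 1 + Tₚ(0) and S₀ + 2S₁ + S₂ = Tₚ(1). The identity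
-- k Tₙ₊₁(k) = (n + 1)(Tₙ(k - 1) - Tₙ(k + 1)) gives S₀ = p (Tₙ(0) - Tₙ(1)), Tₚ(1) = p (Tₙ(0) - Tₙ(2)),
-- and p ∣ Tₚ(k) for 0 < k < p. Hence everything follows from Tₚ(0) mod p² and Tₙ(0), Tₙ(1), Tₙ(2)
-- mod p. Modulo p, Tₙ(a) + Tₙ(a + 1) + Tₙ(a + 2) = Tₚ(a + 1) ≡ 0 for a + 1 < p, so descending from
-- Tₙ(n) = 1, Tₙ(n + 1) = 0 gives Tₙ(a) ≡ legendre3 (p - a). For the centre,
-- (1 - x)ᵖ (1 + x + x⁻¹)ᵖ = x⁻ᵖ (1 - x³)ᵖ has no constant term when 3 ∤ p; expanding (1 - x)ᵖ, all
-- terms but the two extreme ones are divisible by p · p, which leaves Tₚ(0) ≡ 1 (mod p²).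

module Submission where

open import Defs
open import Data.Nat as ℕ using (ℕ; zero; suc; _>_; z≤n; s≤s; NonTrivial)
import Data.Nat.Properties as ℕₚ
import Data.Nat.DivMod as ℕ using (_%_; _/_; m≡m%n+[m/n]*n; m%n<n)
import Data.Nat.Divisibility as ℕ using (_∣_; divides; ∣m∣n⇒∣m+n; ∣-refl)
import Data.Nat.Coprimality as ℕ using (coprime-divisor)
open import Data.Nat.Coprimality using (prime⇒coprime)
open import Data.Nat.Combinatorics using (_C_; k>n⇒nCk≡0; nCk+nC[k+1]≡[n+1]C[k+1]; nC1≡n; nCn≡1)
open import Data.Nat.Primality using (Prime; composite)
import Data.Nat.Tactic.RingSolver as ℕ-Solver
open import Data.Integer using (ℤ; +_; -[1+_]; _+_; _-_; _*_; -_; 0ℤ; 1ℤ)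
open import Data.Integer.DivMod using (_/_)
import Data.Integer.Coprimality as ℤ using (coprime-divisor)
open import Data.Integer.Divisibility.Signed as Signed using (divides)
import Data.Integer.Properties as ℤₚ
open import Data.Integer.Tactic.RingSolver using (solve-∀; solve)
open import Data.List using (foldr; map; applyUpTo; _∷_; [])
open import Data.Product using (_×_; _,_; proj₁; proj₂; ∃-syntax)
open import Function using (_∘_)
open import Level using (0ℓ)
open import Relation.Binary.Bundles using (Setoid)
import Relation.Binary.Reasoning.Setoid
open import Relation.Binary.PropositionalEquality
open import Relation.Nullary using (¬_; contradiction)

-- Congruences

-- The congruence of Defs unfolds to a divisibility of a - b, from which unification cannot
-- recover a and b; this record is the same relation with its arguments kept visible.
infix 4 _≋_[mod_]

record _≋_[mod_] (a b m : ℤ) : Set where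
  constructor mod-divides
  field divides-difference : m Signed.∣ a - b

open _≋_[mod_] public

≋⇒≡-mod : ∀ {a b m} → a ≋ b [mod m ] → a ≡ b [mod m ]
≋⇒≡-mod = Signed.∣⇒∣ᵤ ∘ divides-difference

module _ {m : ℤ} where

  private
    via : ∀ {x a b} → x ≡ a - b → m Signed.∣ x → a ≋ b [mod m ]
    via refl m∣x = mod-divides m∣x

  ≡⇒≋ : ∀ {a b} → a ≡ b → a ≋ b [mod m ]
  ≡⇒≋ {a} refl = mod-divides (divides 0ℤ (ℤₚ.+-inverseʳ a))

  ≋-sym : ∀ {a b} → a ≋ b [mod m ] → b ≋ a [mod m ]
  ≋-sym {a} {b} (mod-divides m∣a-b) = via (flip a b) (Signed.∣m⇒∣-m m∣a-b)
    where
    flip : ∀ a b → - (a - b) ≡ b - a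
    flip = solve-∀

  ≋-trans : ∀ {a b c} → a ≋ b [mod m ] → b ≋ c [mod m ] → a ≋ c [mod m ]
  ≋-trans {a} {b} {c} (mod-divides m∣a-b) (mod-divides m∣b-c) =
    via (chain a b c) (Signed.∣m∣n⇒∣m+n m∣a-b m∣b-c)
    where
    chain : ∀ a b c → (a - b) + (b - c) ≡ a - c
    chain = solve-∀

  ≋-setoid : Setoid 0ℓ 0ℓ
  ≋-setoid = record
    { Carrier       = ℤ
    ; _≈_           = _≋_[mod m ]
    ; isEquivalence = record { refl = ≡⇒≋ refl ; sym = ≋-sym ; trans = ≋-trans }
    }

  +-cong-≋ : ∀ {a b c d} → a ≋ b [mod m ] → c ≋ d [mod m ] → a + c ≋ b + d [mod m ]
  +-cong-≋ {a} {b} {c} {d} (mod-divides m∣a-b) (mod-divides m∣c-d) =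
    via (regroup a b c d) (Signed.∣m∣n⇒∣m+n m∣a-b m∣c-d)
    where
    regroup : ∀ a b c d → (a - b) + (c - d) ≡ (a + c) - (b + d)
    regroup = solve-∀

  -‿cong-≋ : ∀ {a b} → a ≋ b [mod m ] → - a ≋ - b [mod m ]
  -‿cong-≋ {a} {b} (mod-divides m∣a-b) = via (negate a b) (Signed.∣m⇒∣-m m∣a-b)
    where
    negate : ∀ a b → - (a - b) ≡ - a - - b
    negate = solve-∀

  -‑cong-≋ : ∀ {a b c d} → a ≋ b [mod m ] → c ≋ d [mod m ] → a - c ≋ b - d [mod m ]
  -‑cong-≋ a≋b c≋d = +-cong-≋ a≋b (-‿cong-≋ c≋d)

  -‑congˡ-≋ : ∀ a {c d} → c ≋ d [mod m ] → a - c ≋ a - d [mod m ]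
  -‑congˡ-≋ a c≋d = -‑cong-≋ (≡⇒≋ {a = a} refl) c≋d

  -‑congʳ-≋ : ∀ c {a b} → a ≋ b [mod m ] → a - c ≋ b - c [mod m ]
  -‑congʳ-≋ c a≋b = -‑cong-≋ a≋b (≡⇒≋ {a = c} refl)

  *-congˡ-≋ : ∀ c {a b} → a ≋ b [mod m ] → c * a ≋ c * b [mod m ]
  *-congˡ-≋ c {a} {b} (mod-divides m∣a-b) = via (distrib c a b) (Signed.∣n⇒∣m*n c m∣a-b)
    where
    distrib : ∀ c a b → c * (a - b) ≡ c * a - c * b
    distrib = solve-∀

module ≋-Reasoning (m : ℤ) = Relation.Binary.Reasoning.Setoid (≋-setoid {m})

*-cong-≋-scale : ∀ {m} c {a b} → a ≋ b [mod m ] → c * a ≋ c * b [mod c * m ]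
*-cong-≋-scale c {a} {b} (mod-divides m∣a-b) =
  mod-divides (subst (Signed._∣_ _) (distrib c a b) (Signed.*-monoʳ-∣ c m∣a-b))
  where
  distrib : ∀ c a b → c * (a - b) ≡ c * a - c * b
  distrib = solve-∀

*-cancelˡ-≋-2 : ∀ {m} k {a b} → m ≡ 1ℤ + + 2 * k → + 2 * a ≋ + 2 * b [mod m ] → a ≋ b [mod m ]
*-cancelˡ-≋-2 {m} k {a} {b} refl (mod-divides m∣2a-2b) = mod-divides
  (subst (Signed._∣_ m) (odd-modulus k a b)
    (Signed.∣m∣n⇒∣m-n (Signed.∣m⇒∣m*n (a - b) (Signed.∣-refl {m})) (Signed.∣n⇒∣m*n k m∣2a-2b)))
  where
  odd-modulus : ∀ k a b → (1ℤ + + 2 * k) * (a - b) - k * (+ 2 * a - + 2 * b) ≡ a - b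
  odd-modulus = solve-∀

∣⇒≋0 : ∀ {m a} → m Signed.∣ a → a ≋ 0ℤ [mod m ]
∣⇒≋0 {m} {a} m∣a = mod-divides (subst (Signed._∣_ m) (sym (ℤₚ.+-identityʳ a)) m∣a)

*-pres-∣ : ∀ {m n a b} → m Signed.∣ a → n Signed.∣ b → m * n Signed.∣ a * b
*-pres-∣ {m} {n} (divides q refl) (divides r refl) = divides (q * r) (interchange q m r n)
  where
  interchange : ∀ q m r n → q * m * (r * n) ≡ q * r * (m * n)
  interchange = solve-∀

-- Finite sums

∑ : ℕ → (ℕ → ℤ) → ℤ
∑ zero    f = 0ℤ
∑ (suc n) f = f 0 + ∑ n (f ∘ suc)

syntax ∑ n (λ i → e) = ∑[ i < n ] e

∑-cong : ∀ n {f g : ℕ → ℤ} → (∀ i → f i ≡ g i) → ∑ n f ≡ ∑ n g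
∑-cong zero    f≗g = refl
∑-cong (suc n) f≗g = cong₂ _+_ (f≗g 0) (∑-cong n (f≗g ∘ suc))

∑-last : ∀ n f → ∑ (suc n) f ≡ ∑ n f + f n
∑-last zero    f = ℤₚ.+-comm (f 0) 0ℤ
∑-last (suc n) f = trans (cong (_+_ (f 0)) (∑-last n (f ∘ suc))) (sym (ℤₚ.+-assoc (f 0) _ _))

∑-vanishing-last : ∀ n f → f n ≡ 0ℤ → ∑ (suc n) f ≡ ∑ n f
∑-vanishing-last n f fn≡0 =
  trans (∑-last n f) (trans (cong (_+_ (∑ n f)) fn≡0) (ℤₚ.+-identityʳ (∑ n f)))

∑-distrib-- : ∀ n f g → ∑[ i < n ] (f i - g i) ≡ ∑ n f - ∑ n g
∑-distrib-- zero    f g = refl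
∑-distrib-- (suc n) f g =
  trans (cong (_+_ (f 0 - g 0)) (∑-distrib-- n (f ∘ suc) (g ∘ suc))) (interchange (f 0) (g 0) _ _)
  where
  interchange : ∀ a b c d → a - b + (c - d) ≡ a + c - (b + d)
  interchange = solve-∀

∑-∣ : ∀ {d} n f → (∀ i → i ℕ.< n → d Signed.∣ f i) → d Signed.∣ ∑ n f
∑-∣ zero    f d∣f = divides 0ℤ refl
∑-∣ (suc n) f d∣f =
  Signed.∣m∣n⇒∣m+n (d∣f 0 (s≤s z≤n)) (∑-∣ n (f ∘ suc) (λ i i<n → d∣f (suc i) (s≤s i<n)))

∑-applyUpTo : ∀ n (f : ℕ → ℕ) (g : ℕ → ℤ) →
  foldr _+_ 0ℤ (map g (applyUpTo f n)) ≡ ∑[ i < n ] g (f i)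
∑-applyUpTo zero    f g = refl
∑-applyUpTo (suc n) f g = cong (_+_ (g (f 0))) (∑-applyUpTo n (f ∘ suc) g)

-- Binomial coefficients and primes

[k+1]*[n+1]C[k+1]≡[n+1]*nCk : ∀ n k → suc k ℕ.* (suc n C suc k) ≡ suc n ℕ.* (n C k)
[k+1]*[n+1]C[k+1]≡[n+1]*nCk zero    zero    = refl
[k+1]*[n+1]C[k+1]≡[n+1]*nCk zero    (suc k) = ℕₚ.*-zeroʳ (suc (suc k))
[k+1]*[n+1]C[k+1]≡[n+1]*nCk (suc n) zero    =
  trans (ℕₚ.*-identityˡ _) (trans (nC1≡n (suc (suc n))) (sym (ℕₚ.*-identityʳ (suc (suc n)))))
[k+1]*[n+1]C[k+1]≡[n+1]*nCk (suc n) (suc k) = begin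
  suc (suc k) ℕ.* (suc (suc n) C suc (suc k))
    ≡⟨ cong (suc (suc k) ℕ.*_) (sym (nCk+nC[k+1]≡[n+1]C[k+1] (suc n) (suc k))) ⟩
  suc (suc k) ℕ.* (suc n C suc k ℕ.+ suc n C suc (suc k))
    ≡⟨ split (suc k) (suc n C suc k) (suc n C suc (suc k)) ⟩
  suc k ℕ.* (suc n C suc k) ℕ.+ suc n C suc k ℕ.+ suc (suc k) ℕ.* (suc n C suc (suc k))
    ≡⟨ cong₂ (λ x y → x ℕ.+ suc n C suc k ℕ.+ y)
         ([k+1]*[n+1]C[k+1]≡[n+1]*nCk n k) ([k+1]*[n+1]C[k+1]≡[n+1]*nCk n (suc k)) ⟩
  suc n ℕ.* (n C k) ℕ.+ suc n C suc k ℕ.+ suc n ℕ.* (n C suc k)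
    ≡⟨ collect (suc n) (n C k) (n C suc k) (suc n C suc k) ⟩
  suc n ℕ.* (n C k ℕ.+ n C suc k) ℕ.+ suc n C suc k
    ≡⟨ cong (λ x → suc n ℕ.* x ℕ.+ suc n C suc k) (nCk+nC[k+1]≡[n+1]C[k+1] n k) ⟩
  suc n ℕ.* (suc n C suc k) ℕ.+ suc n C suc k
    ≡⟨ ℕₚ.+-comm (suc n ℕ.* (suc n C suc k)) _ ⟩
  suc (suc n) ℕ.* (suc n C suc k) ∎
  where
  open ≡-Reasoning
  split : ∀ k x y → suc k ℕ.* (x ℕ.+ y) ≡ k ℕ.* x ℕ.+ x ℕ.+ suc k ℕ.* y
  split = ℕ-Solver.solve-∀
  collect : ∀ m x y z → m ℕ.* x ℕ.+ z ℕ.+ m ℕ.* y ≡ m ℕ.* (x ℕ.+ y) ℕ.+ z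
  collect = ℕ-Solver.solve-∀

prime∣pCk : ∀ {p k} → Prime p → 0 ℕ.< k → k ℕ.< p → p ℕ.∣ p C k
prime∣pCk {suc n} {suc j} p-prime _ k<p = ℕ.coprime-divisor (prime⇒coprime p-prime k<p)
  (ℕ.divides (n C j) (trans ([k+1]*[n+1]C[k+1]≡[n+1]*nCk n j) (ℕₚ.*-comm (suc n) (n C j))))

prime⇒¬∣ : ∀ {p d} .{{_ : NonTrivial d}} → Prime p → d ℕ.< p → ¬ d ℕ.∣ p
prime⇒¬∣ p-prime d<p d∣p = Prime.notComposite p-prime (composite d<p d∣p)

prime⇒odd : ∀ {p} → Prime p → 2 ℕ.< p → ∃[ q ] p ≡ suc (q ℕ.* 2)
prime⇒odd {p} p-prime 2<p with p ℕ.% 2 | ℕ.m≡m%n+[m/n]*n p 2 | ℕ.m%n<n p 2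
... | 0           | p≡[p/2]*2   | _ = contradiction (ℕ.divides (p ℕ./ 2) p≡[p/2]*2) (prime⇒¬∣ p-prime 2<p)
... | 1           | p≡1+[p/2]*2 | _ = p ℕ./ 2 , p≡1+[p/2]*2
... | suc (suc _) | _           | s≤s (s≤s ())

-- Trinomial coefficients

trinom-sym : ∀ n k → trinom n (- k) ≡ trinom n k
trinom-sym zero    (+ zero)  = refl
trinom-sym zero    (+ suc _) = refl
trinom-sym zero    -[1+ _ ]  = refl
trinom-sym (suc n) k = begin
  T (- k - 1ℤ) + T (- k) + T (- k + 1ℤ)
    ≡⟨ cong₂ (λ x y → T x + T (- k) + T y) (neg-pred k) (neg-suc k) ⟩
  T (- (k + 1ℤ)) + T (- k) + T (- (k - 1ℤ))
    ≡⟨ cong₂ (λ x y → x + T (- k) + y) (trinom-sym n (k + 1ℤ)) (trinom-sym n (k - 1ℤ)) ⟩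
  T (k + 1ℤ) + T (- k) + T (k - 1ℤ)
    ≡⟨ cong (λ x → T (k + 1ℤ) + x + T (k - 1ℤ)) (trinom-sym n k) ⟩
  T (k + 1ℤ) + T k + T (k - 1ℤ)
    ≡⟨ reverse (T (k - 1ℤ)) (T k) (T (k + 1ℤ)) ⟩
  T (k - 1ℤ) + T k + T (k + 1ℤ) ∎
  where
  open ≡-Reasoning
  T = trinom n
  neg-pred : ∀ k → - k - 1ℤ ≡ - (k + 1ℤ)
  neg-pred = solve-∀
  neg-suc : ∀ k → - k + 1ℤ ≡ - (k - 1ℤ)
  neg-suc = solve-∀
  reverse : ∀ x y z → z + y + x ≡ x + y + z
  reverse = solve-∀

trinom-vanishes : ∀ {n k} → n ℕ.< k → trinom n (+ k) ≡ 0ℤ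
trinom-vanishes {zero}  {suc k} _ = refl
trinom-vanishes {suc n} {suc k} (s≤s n<k) =
  cong₂ _+_ (cong₂ _+_ (trinom-vanishes n<k) (trinom-vanishes (ℕₚ.m<n⇒m<1+n n<k)))
            (trinom-vanishes (ℕₚ.m≤n⇒m≤n+o 1 (ℕₚ.m<n⇒m<1+n n<k)))

trinom-diagonal : ∀ n → trinom n (+ n) ≡ 1ℤ
trinom-diagonal zero    = refl
trinom-diagonal (suc n) =
  cong₂ _+_ (cong₂ _+_ (trinom-diagonal n) (trinom-vanishes (ℕₚ.n<1+n n)))
            (trinom-vanishes (ℕₚ.m≤n⇒m≤n+o 1 (ℕₚ.n<1+n n)))

private
  pred-suc : ∀ k → k - 1ℤ + 1ℤ ≡ k
  pred-suc = solve-∀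
  suc-pred : ∀ k → k + 1ℤ - 1ℤ ≡ k
  suc-pred = solve-∀
  weigh : ∀ k x y z → k * (x + y + z) ≡ (k - 1ℤ) * x + k * y + (k + 1ℤ) * z + 1ℤ * (x - z)
  weigh = solve-∀

k*trinom0k≡0 : ∀ k → k * trinom 0 k ≡ 0ℤ
k*trinom0k≡0 (+ zero)  = refl
k*trinom0k≡0 (+ suc k) = ℤₚ.*-zeroʳ (+ suc k)
k*trinom0k≡0 -[1+ k ]  = ℤₚ.*-zeroʳ -[1+ k ]

-- The coefficient form of x d/dx (1 + x + x⁻¹)ⁿ⁺¹ = (n + 1) (x - x⁻¹) (1 + x + x⁻¹)ⁿ.
trinom-deriv : ∀ n k → k * trinom (suc n) k ≡ + suc n * (trinom n (k - 1ℤ) - trinom n (k + 1ℤ))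
trinom-deriv zero k = begin
  k * (T (k - 1ℤ) + T k + T (k + 1ℤ))
    ≡⟨ weigh k (T (k - 1ℤ)) (T k) (T (k + 1ℤ)) ⟩
  (k - 1ℤ) * T (k - 1ℤ) + k * T k + (k + 1ℤ) * T (k + 1ℤ) + 1ℤ * (T (k - 1ℤ) - T (k + 1ℤ))
    ≡⟨ cong (_+ 1ℤ * (T (k - 1ℤ) - T (k + 1ℤ)))
         (cong₂ _+_ (cong₂ _+_ (k*trinom0k≡0 (k - 1ℤ)) (k*trinom0k≡0 k)) (k*trinom0k≡0 (k + 1ℤ))) ⟩
  0ℤ + 1ℤ * (T (k - 1ℤ) - T (k + 1ℤ))
    ≡⟨ ℤₚ.+-identityˡ _ ⟩
  1ℤ * (T (k - 1ℤ) - T (k + 1ℤ)) ∎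
  where
  open ≡-Reasoning
  T = trinom 0
trinom-deriv (suc n) k = begin
  k * (X + Y + Z)
    ≡⟨ weigh k X Y Z ⟩
  (k - 1ℤ) * X + k * Y + (k + 1ℤ) * Z + 1ℤ * (X - Z)
    ≡⟨ cong (_+ 1ℤ * (X - Z)) (cong₂ _+_ (cong₂ _+_ (trinom-deriv n (k - 1ℤ)) (trinom-deriv n k))
                                        (trinom-deriv n (k + 1ℤ))) ⟩
  N * (a - c) + N * (b - d) + N * (c′ - e) + 1ℤ * (X - Z)
    ≡⟨ cong (λ t → N * (a - c) + N * (b - d) + N * (t - e) + 1ℤ * (a + b + c - (t + d + e))) (sym c≡c′) ⟩
  N * (a - c) + N * (b - d) + N * (c - e) + 1ℤ * (a + b + c - (c + d + e))
    ≡⟨ collect N a b c d e ⟩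
  (1ℤ + N) * (a + b + c - (c + d + e))
    ≡⟨ cong (λ t → (1ℤ + N) * (a + b + c - (t + d + e))) c≡c′ ⟩
  (1ℤ + N) * (X - Z) ∎
  where
  open ≡-Reasoning
  N = + suc n
  X = trinom (suc n) (k - 1ℤ)
  Y = trinom (suc n) k
  Z = trinom (suc n) (k + 1ℤ)
  a = trinom n (k - 1ℤ - 1ℤ)
  b = trinom n (k - 1ℤ)
  c = trinom n (k - 1ℤ + 1ℤ)
  c′ = trinom n (k + 1ℤ - 1ℤ)
  d = trinom n (k + 1ℤ)
  e = trinom n (k + 1ℤ + 1ℤ)
  c≡c′ : c ≡ c′
  c≡c′ = cong (trinom n) (trans (pred-suc k) (sym (suc-pred k)))
  collect : ∀ N a b c d e → N * (a - c) + N * (b - d) + N * (c - e) + 1ℤ * (a + b + c - (c + d + e))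
                         ≡ (1ℤ + N) * (a + b + c - (c + d + e))
  collect = solve-∀

prime∣trinom : ∀ {p k} → Prime p → 0 ℕ.< k → k ℕ.< p → + p Signed.∣ trinom p (+ k)
prime∣trinom {suc n} {k} p-prime 0<k k<p = Signed.∣ᵤ⇒∣
  (ℤ.coprime-divisor (+ suc n) (+ k) _ (prime⇒coprime p-prime {{ℕ.>-nonZero 0<k}} k<p)
    (Signed.∣⇒∣ᵤ (divides {+ suc n} (trinom n (+ k - 1ℤ) - trinom n (+ k + 1ℤ))
      (trans (trinom-deriv n (+ k)) (ℤₚ.*-comm (+ suc n) _)))))

-- Alternating sums

sgn-even : ∀ q → sgn (q ℕ.* 2) ≡ 1ℤ
sgn-even zero    = refl
sgn-even (suc q) = trans (ℤₚ.neg-involutive (sgn (q ℕ.* 2))) (sgn-even q)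

altSum-suc : ∀ n j → altSum (suc n) j ≡ altSum n j + sgn n * trinom n j
altSum-suc n j = begin
  altSum (suc n) j ≡⟨ ∑-applyUpTo (suc n) (λ k → k) f ⟩
  ∑ (suc n) f      ≡⟨ ∑-last n f ⟩
  ∑ n f + f n      ≡⟨ cong (_+ f n) (∑-applyUpTo n (λ k → k) f) ⟨
  altSum n j + f n ∎
  where
  open ≡-Reasoning
  f = λ k → sgn k * trinom k j

altSum-telescope : ∀ a b c (g : ℕ → ℤ) →
  (∀ k → a * trinom k 0ℤ + b * trinom k 1ℤ + c * trinom k (+ 2) ≡ g (suc k) + g k) →
  ∀ n → a * altSum n 0ℤ + b * altSum n 1ℤ + c * altSum n (+ 2) ≡ g 0 - sgn n * g n
altSum-telescope a b c g step zero = empty a b c (g 0)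
  where
  empty : ∀ a b c x → a * 0ℤ + b * 0ℤ + c * 0ℤ ≡ x - 1ℤ * x
  empty = solve-∀
altSum-telescope a b c g step (suc n)
  rewrite altSum-suc n 0ℤ | altSum-suc n 1ℤ | altSum-suc n (+ 2) = begin
    a * (A₀ + s * t₀) + b * (A₁ + s * t₁) + c * (A₂ + s * t₂)
      ≡⟨ regroup a b c A₀ A₁ A₂ s t₀ t₁ t₂ ⟩
    (a * A₀ + b * A₁ + c * A₂) + s * (a * t₀ + b * t₁ + c * t₂)
      ≡⟨ cong₂ (λ x y → x + s * y) (altSum-telescope a b c g step n) (step n) ⟩
    (g 0 - s * g n) + s * (g (suc n) + g n)
      ≡⟨ cancel (g 0) (g n) (g (suc n)) s ⟩
    g 0 - - s * g (suc n) ∎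
  where
  open ≡-Reasoning
  s = sgn n
  A₀ = altSum n 0ℤ
  A₁ = altSum n 1ℤ
  A₂ = altSum n (+ 2)
  t₀ = trinom n 0ℤ
  t₁ = trinom n 1ℤ
  t₂ = trinom n (+ 2)
  regroup : ∀ a b c A₀ A₁ A₂ s t₀ t₁ t₂ →
    a * (A₀ + s * t₀) + b * (A₁ + s * t₁) + c * (A₂ + s * t₂) ≡
    (a * A₀ + b * A₁ + c * A₂) + s * (a * t₀ + b * t₁ + c * t₂)
  regroup = solve-∀
  cancel : ∀ x y z s → (x - s * y) + s * (z + y) ≡ x - - s * z
  cancel = solve-∀

altSum-0-closed : ∀ n → altSum (suc n) 0ℤ ≡ sgn n * (+ suc n * (trinom n 0ℤ - trinom n 1ℤ))
altSum-0-closed zero    = refl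
altSum-0-closed (suc n) = begin
  altSum (suc (suc n)) 0ℤ
    ≡⟨ altSum-suc (suc n) 0ℤ ⟩
  altSum (suc n) 0ℤ + - s * (trinom n -[1+ 0 ] + t₀ + t₁)
    ≡⟨ cong₂ (λ x y → x + - s * (y + t₀ + t₁)) (altSum-0-closed n) (trinom-sym n 1ℤ) ⟩
  s * (N * (t₀ - t₁)) + - s * T₀
    ≡⟨ expand s N t₀ t₁ t₂ ⟩
  - s * ((1ℤ + N) * T₀ - N * (t₀ - t₂) - N * T₁)
    ≡⟨ cong (λ x → - s * ((1ℤ + N) * T₀ - x - N * T₁))
         (trans (sym (ℤₚ.*-identityˡ T₁)) (trinom-deriv n 1ℤ)) ⟨
  - s * ((1ℤ + N) * T₀ - T₁ - N * T₁)
    ≡⟨ factor s N T₀ T₁ ⟩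
  - s * ((1ℤ + N) * (T₀ - T₁))
    ≡⟨ cong (λ x → - s * ((1ℤ + N) * (x + t₀ + t₁ - T₁))) (trinom-sym n 1ℤ) ⟨
  - s * ((1ℤ + N) * (trinom (suc n) 0ℤ - T₁)) ∎
  where
  open ≡-Reasoning
  s = sgn n
  N = + suc n
  t₀ = trinom n 0ℤ
  t₁ = trinom n 1ℤ
  t₂ = trinom n (+ 2)
  T₀ = t₁ + t₀ + t₁
  T₁ = trinom (suc n) 1ℤ
  expand : ∀ s N t₀ t₁ t₂ → s * (N * (t₀ - t₁)) + - s * (t₁ + t₀ + t₁) ≡
           - s * ((1ℤ + N) * (t₁ + t₀ + t₁) - N * (t₀ - t₂) - N * (t₀ + t₁ + t₂))
  expand = solve-∀
  factor : ∀ s N x y → - s * ((1ℤ + N) * x - y - N * y) ≡ - s * ((1ℤ + N) * (x - y))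
  factor = solve-∀

-- Backward differences

-- On coefficient sequences, ∇ a is multiplication by (1 - x)ᵃ.
∇ : ℕ → (ℤ → ℤ) → ℤ → ℤ
∇ zero    f k = f k
∇ (suc a) f k = ∇ a f k - ∇ a f (k - 1ℤ)

∇-three-term : ∀ a f k →
  ∇ a (λ x → f (x - 1ℤ) + f x + f (x + 1ℤ)) k ≡ ∇ a f (k - 1ℤ) + ∇ a f k + ∇ a f (k + 1ℤ)
∇-three-term zero    f k = refl
∇-three-term (suc a) f k = begin
  ∇ (suc a) (λ x → f (x - 1ℤ) + f x + f (x + 1ℤ)) k
    ≡⟨ cong₂ _-_ (∇-three-term a f k) (∇-three-term a f (k - 1ℤ)) ⟩
  (P (k - 1ℤ) + P k + P (k + 1ℤ)) - (P (k - 1ℤ - 1ℤ) + P (k - 1ℤ) + P (k - 1ℤ + 1ℤ))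
    ≡⟨ cong (λ x → (P (k - 1ℤ) + P k + P (k + 1ℤ)) - (P (k - 1ℤ - 1ℤ) + P (k - 1ℤ) + P x)) (pred-suc k) ⟩
  (P (k - 1ℤ) + P k + P (k + 1ℤ)) - (P (k - 1ℤ - 1ℤ) + P (k - 1ℤ) + P k)
    ≡⟨ telescope (P (k - 1ℤ - 1ℤ)) (P (k - 1ℤ)) (P k) (P (k + 1ℤ)) ⟩
  (P (k - 1ℤ) - P (k - 1ℤ - 1ℤ)) + (P k - P (k - 1ℤ)) + (P (k + 1ℤ) - P k)
    ≡⟨ cong (λ x → (P (k - 1ℤ) - P (k - 1ℤ - 1ℤ)) + (P k - P (k - 1ℤ)) + (P (k + 1ℤ) - P x)) (suc-pred k) ⟨
  ∇ (suc a) f (k - 1ℤ) + ∇ (suc a) f k + ∇ (suc a) f (k + 1ℤ) ∎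
  where
  open ≡-Reasoning
  P = ∇ a f
  telescope : ∀ w x y z → (x + y + z) - (w + x + y) ≡ (x - w) + (y - x) + (z - y)
  telescope = solve-∀

-- Multiplying by 1 - x turns 1 + x + x⁻¹ into x⁻¹ - x².
∇-trinom : ∀ a k → ∇ (suc a) (trinom (suc a)) k ≡ ∇ a (trinom a) (k + 1ℤ) - ∇ a (trinom a) (k - 1ℤ - 1ℤ)
∇-trinom a k = begin
  ∇ a (trinom (suc a)) k - ∇ a (trinom (suc a)) (k - 1ℤ)
    ≡⟨ cong₂ _-_ (∇-three-term a (trinom a) k) (∇-three-term a (trinom a) (k - 1ℤ)) ⟩
  (P (k - 1ℤ) + P k + P (k + 1ℤ)) - (P (k - 1ℤ - 1ℤ) + P (k - 1ℤ) + P (k - 1ℤ + 1ℤ))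
    ≡⟨ cong (λ x → (P (k - 1ℤ) + P k + P (k + 1ℤ)) - (P (k - 1ℤ - 1ℤ) + P (k - 1ℤ) + P x)) (pred-suc k) ⟩
  (P (k - 1ℤ) + P k + P (k + 1ℤ)) - (P (k - 1ℤ - 1ℤ) + P (k - 1ℤ) + P k)
    ≡⟨ cancel (P (k - 1ℤ - 1ℤ)) (P (k - 1ℤ)) (P k) (P (k + 1ℤ)) ⟩
  P (k + 1ℤ) - P (k - 1ℤ - 1ℤ) ∎
  where
  open ≡-Reasoning
  P = ∇ a (trinom a)
  cancel : ∀ w x y z → (x + y + z) - (w + x + y) ≡ z - w
  cancel = solve-∀

∇-trinom-vanishes : ∀ n k → ¬ (+ 3 Signed.∣ k + + n) → ∇ n (trinom n) k ≡ 0ℤ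
∇-trinom-vanishes zero    (+ zero)  3∤k = contradiction (divides 0ℤ refl) 3∤k
∇-trinom-vanishes zero    (+ suc _) _   = refl
∇-trinom-vanishes zero    -[1+ _ ]  _   = refl
∇-trinom-vanishes (suc n) k 3∤k+n+1 = begin
  ∇ (suc n) (trinom (suc n)) k
    ≡⟨ ∇-trinom n k ⟩
  ∇ n (trinom n) (k + 1ℤ) - ∇ n (trinom n) (k - 1ℤ - 1ℤ)
    ≡⟨ cong₂ _-_ (∇-trinom-vanishes n (k + 1ℤ) 3∤above) (∇-trinom-vanishes n (k - 1ℤ - 1ℤ) 3∤below) ⟩
  0ℤ ∎
  where
  open ≡-Reasoning
  3∤above : ¬ (+ 3 Signed.∣ k + 1ℤ + + n)
  3∤above = 3∤k+n+1 ∘ subst (Signed._∣_ (+ 3)) (shift k (+ n))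
    where
    shift : ∀ k n → k + 1ℤ + n ≡ k + (1ℤ + n)
    shift = solve-∀
  3∤below : ¬ (+ 3 Signed.∣ k - 1ℤ - 1ℤ + + n)
  3∤below 3∣x = 3∤k+n+1 (subst (Signed._∣_ (+ 3)) (shift k (+ n)) (Signed.∣m∣n⇒∣m+n 3∣x Signed.∣-refl))
    where
    shift : ∀ k n → k - 1ℤ - 1ℤ + n + + 3 ≡ k + (1ℤ + n)
    shift = solve-∀

∇-expansion : ∀ a f k → ∇ a f k ≡ ∑[ j < suc a ] (sgn j * + (a C j) * f (k - + j))
∇-expansion zero    f k =
  sym (trans (ℤₚ.+-identityʳ _) (trans (ℤₚ.*-identityˡ _) (cong f (ℤₚ.+-identityʳ k))))
∇-expansion (suc a) f k = begin
  ∇ a f k - ∇ a f (k - 1ℤ)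
    ≡⟨ cong₂ _-_ (∇-expansion a f k) (∇-expansion a f (k - 1ℤ)) ⟩
  ∑ (suc a) (term a k) - ∑ (suc a) (term a (k - 1ℤ))
    ≡⟨ cong (_- ∑ (suc a) (term a (k - 1ℤ))) (∑-vanishing-last (suc a) (term a k) top-vanishes) ⟨
  term a k 0 + ∑ (suc a) (term a k ∘ suc) - ∑ (suc a) (term a (k - 1ℤ))
    ≡⟨ ℤₚ.+-assoc (term a k 0) _ _ ⟩
  term a k 0 + (∑ (suc a) (term a k ∘ suc) - ∑ (suc a) (term a (k - 1ℤ)))
    ≡⟨ cong (_+_ (term a k 0)) (∑-distrib-- (suc a) (term a k ∘ suc) (term a (k - 1ℤ))) ⟨
  term a k 0 + ∑[ i < suc a ] (term a k (suc i) - term a (k - 1ℤ) i)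
    ≡⟨ cong (_+_ (term a k 0)) (∑-cong (suc a) pascal) ⟩
  ∑ (suc (suc a)) (term (suc a) k) ∎
  where
  open ≡-Reasoning
  term : ℕ → ℤ → ℕ → ℤ
  term b x j = sgn j * + (b C j) * f (x - + j)
  top-vanishes : term a k (suc a) ≡ 0ℤ
  top-vanishes = trans (cong (λ c → sgn (suc a) * + c * f (k - + suc a)) (k>n⇒nCk≡0 (ℕₚ.n<1+n a)))
                       (annihilate (sgn (suc a)) (f (k - + suc a)))
    where
    annihilate : ∀ s x → s * 0ℤ * x ≡ 0ℤ
    annihilate = solve-∀
  pascal : ∀ i → term a k (suc i) - term a (k - 1ℤ) i ≡ term (suc a) k (suc i)
  pascal i = begin
    - s * + (a C suc i) * f (k - + suc i) - s * + (a C i) * f (k - 1ℤ - + i)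
      ≡⟨ cong (λ x → - s * + (a C suc i) * f (k - + suc i) - s * + (a C i) * f x) (shift k (+ i)) ⟩
    - s * + (a C suc i) * f (k - + suc i) - s * + (a C i) * f (k - + suc i)
      ≡⟨ collect s (+ (a C i)) (+ (a C suc i)) (f (k - + suc i)) ⟩
    - s * (+ (a C i) + + (a C suc i)) * f (k - + suc i)
      ≡⟨ cong (λ c → - s * + c * f (k - + suc i)) (nCk+nC[k+1]≡[n+1]C[k+1] a i) ⟩
    term (suc a) k (suc i) ∎
    where
    s = sgn i
    shift : ∀ k i → k - 1ℤ - i ≡ k - (1ℤ + i)
    shift = solve-∀
    collect : ∀ s x y z → - s * y * z - s * x * z ≡ - s * (x + y) * z
    collect = solve-∀

trinom-prime-centre : ∀ {p} → Prime p → ¬ 3 ℕ.∣ p → trinom p 0ℤ ≋ - sgn p [mod + p * + p ]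
trinom-prime-centre {suc n} p-prime 3∤p = begin
  trinom p 0ℤ
    ≡⟨ isolate (trinom p 0ℤ) M (sgn p) ⟩
  (trinom p 0ℤ + (M + sgn p)) - M - sgn p
    ≡⟨ cong (λ x → x - M - sgn p) (trans split vanishing) ⟩
  0ℤ - M - sgn p
    ≈⟨ -‑congʳ-≋ (sgn p) (-‑congˡ-≋ 0ℤ (∣⇒≋0 p²∣M)) ⟩
  0ℤ - 0ℤ - sgn p
    ≡⟨ ℤₚ.+-identityˡ (- sgn p) ⟩
  - sgn p ∎
  where
  open ≋-Reasoning (+ suc n * + suc n)
  p = suc n
  g : ℕ → ℤ
  g j = sgn j * + (p C j) * trinom p (0ℤ - + j)
  M = ∑ n (g ∘ suc)
  vanishing : ∑ (suc p) g ≡ 0ℤ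
  vanishing = trans (sym (∇-expansion p (trinom p) 0ℤ)) (∇-trinom-vanishes p 0ℤ (3∤p ∘ Signed.∣⇒∣ᵤ))
  first : g 0 ≡ trinom p 0ℤ
  first = ℤₚ.*-identityˡ (trinom p 0ℤ)
  last : g p ≡ sgn p
  last = trans (cong₂ (λ c x → sgn p * + c * trinom p x) (nCn≡1 p) (ℤₚ.+-identityˡ (- + p)))
               (trans (cong (sgn p * 1ℤ *_) (trans (trinom-sym p (+ p)) (trinom-diagonal p))) (units (sgn p)))
    where
    units : ∀ s → s * 1ℤ * 1ℤ ≡ s
    units = solve-∀
  split : trinom p 0ℤ + (M + sgn p) ≡ ∑ (suc p) g
  split = cong₂ _+_ (sym first) (trans (cong (_+_ M) (sym last)) (sym (∑-last n (g ∘ suc))))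
  p²∣M : + p * + p Signed.∣ M
  p²∣M = ∑-∣ n (g ∘ suc) λ i i<n → *-pres-∣ (p∣coefficient i<n) (p∣trinom-at i<n)
    where
    p∣coefficient : ∀ {i} → i ℕ.< n → + p Signed.∣ sgn (suc i) * + (p C suc i)
    p∣coefficient {i} i<n =
      Signed.∣n⇒∣m*n (sgn (suc i)) (Signed.∣ᵤ⇒∣ {+ p} (prime∣pCk p-prime (s≤s z≤n) (s≤s i<n)))
    p∣trinom-at : ∀ {i} → i ℕ.< n → + p Signed.∣ trinom p (0ℤ - + suc i)
    p∣trinom-at {i} i<n = subst (Signed._∣_ (+ p))
      (sym (trans (cong (trinom p) (ℤₚ.+-identityˡ (- + suc i))) (trinom-sym p (+ suc i))))
      (prime∣trinom p-prime (s≤s z≤n) (s≤s i<n))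
  isolate : ∀ t m s → t ≡ (t + (m + s)) - m - s
  isolate = solve-∀

-- Reduction modulo p

legendre3-recurrence : ∀ r → legendre3 (suc (suc r)) ≡ - (legendre3 (suc r) + legendre3 r)
legendre3-recurrence 0                   = refl
legendre3-recurrence 1                   = refl
legendre3-recurrence 2                   = refl
legendre3-recurrence (suc (suc (suc r))) = legendre3-recurrence r

legendre3-difference : ∀ n → ¬ 3 ℕ.∣ suc n →
  legendre3 (suc n) - legendre3 n ≡ (+ 3 * legendre3 (suc n) - 1ℤ) / + 2
legendre3-difference 0                   _   = refl
legendre3-difference 1                   _   = refl
legendre3-difference 2                   3∤3 = contradiction (ℕ.divides 1 refl) 3∤3
legendre3-difference (suc (suc (suc n))) 3∤n = legendre3-difference n (3∤n ∘ ℕ.∣m∣n⇒∣m+n (ℕ.∣-refl {3}))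

trinom-pred-prime≋legendre3 : ∀ {n} → Prime (suc n) → ∀ r {a} → a ℕ.+ r ≡ n →
  (trinom n (+ a) ≋ legendre3 (suc r) [mod + suc n ]) × (trinom n (+ suc a) ≋ legendre3 r [mod + suc n ])
trinom-pred-prime≋legendre3 {n} p-prime zero {a} a+0≡n with trans (sym (ℕₚ.+-identityʳ a)) a+0≡n
... | refl = ≡⇒≋ (trinom-diagonal n) , ≡⇒≋ (trinom-vanishes (ℕₚ.n<1+n n))
trinom-pred-prime≋legendre3 {n} p-prime (suc r) {a} a+r+1≡n = next , proj₁ above
  where
  above = trinom-pred-prime≋legendre3 p-prime r {suc a} (trans (sym (ℕₚ.+-suc a r)) a+r+1≡n)
  a<n : a ℕ.< n
  a<n = subst (a ℕ.<_) a+r+1≡n (ℕₚ.m<m+n a (s≤s z≤n))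
  next : trinom n (+ a) ≋ legendre3 (suc (suc r)) [mod + suc n ]
  next = begin
    T (+ a)
      ≡⟨ isolate (T (+ a)) (T (+ suc a)) (T (+ suc (suc a))) ⟩
    T (+ a) + T (+ suc a) + T (+ suc (suc a)) - T (+ suc a) - T (+ suc (suc a))
      ≡⟨ cong (λ k → T (+ a) + T (+ suc a) + T (+ k) - T (+ suc a) - T (+ suc (suc a))) (ℕₚ.+-comm 1 (suc a)) ⟩
    trinom (suc n) (+ suc a) - T (+ suc a) - T (+ suc (suc a))
      ≈⟨ -‑cong-≋ (-‑cong-≋ (∣⇒≋0 (prime∣trinom p-prime (s≤s z≤n) (s≤s a<n))) (proj₁ above))
                  (proj₂ above) ⟩
    0ℤ - legendre3 (suc r) - legendre3 r
      ≡⟨ negate (legendre3 (suc r)) (legendre3 r) ⟩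
    - (legendre3 (suc r) + legendre3 r)
      ≡⟨ legendre3-recurrence r ⟨
    legendre3 (suc (suc r)) ∎
    where
    open ≋-Reasoning (+ suc n)
    T = trinom n
    isolate : ∀ x y z → x ≡ x + y + z - y - z
    isolate = solve-∀
    negate : ∀ x y → 0ℤ - x - y ≡ - (x + y)
    negate = solve-∀

module AltSumsModPrimeSquare (q : ℕ) {c₀ c₁ c₂ : ℤ}
  (central : trinom (suc (q ℕ.* 2)) 0ℤ ≋ - sgn (suc (q ℕ.* 2)) [mod + suc (q ℕ.* 2) * + suc (q ℕ.* 2) ])
  (t₀≋c₀ : trinom (q ℕ.* 2) 0ℤ ≋ c₀ [mod + suc (q ℕ.* 2) ])
  (t₁≋c₁ : trinom (q ℕ.* 2) 1ℤ ≋ c₁ [mod + suc (q ℕ.* 2) ])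
  (t₂≋c₂ : trinom (q ℕ.* 2) (+ 2) ≋ c₂ [mod + suc (q ℕ.* 2) ])
  where

  private
    n = q ℕ.* 2
    P = + suc n
    S₀ = altSum (suc n) 0ℤ
    S₁ = altSum (suc n) 1ℤ
    S₂ = altSum (suc n) (+ 2)

  altSum-0-mod : S₀ ≋ P * (c₀ - c₁) [mod P * P ]
  altSum-0-mod = begin
    S₀                                          ≡⟨ altSum-0-closed n ⟩
    sgn n * (P * (trinom n 0ℤ - trinom n 1ℤ))   ≡⟨ cong (_* (P * (trinom n 0ℤ - trinom n 1ℤ))) (sgn-even q) ⟩
    1ℤ * (P * (trinom n 0ℤ - trinom n 1ℤ))      ≡⟨ ℤₚ.*-identityˡ _ ⟩
    P * (trinom n 0ℤ - trinom n 1ℤ)             ≈⟨ *-cong-≋-scale P (-‑cong-≋ t₀≋c₀ t₁≋c₁) ⟩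
    P * (c₀ - c₁) ∎
    where open ≋-Reasoning (P * P)

  altSum-1-mod : S₁ ≋ 1ℤ - P * (c₀ - c₁) [mod P * P ]
  altSum-1-mod = *-cancelˡ-≋-2 (+ 2 * + q + + 2 * + q * + q) P²-odd (begin
    + 2 * S₁
      ≡⟨ isolate S₀ S₁ S₂ ⟩
    (+ 2 * S₀ + + 2 * S₁ + 0ℤ * S₂) - + 2 * S₀
      ≡⟨ cong (_- + 2 * S₀) (altSum-telescope (+ 2) (+ 2) 0ℤ (λ k → trinom k 0ℤ) step (suc n)) ⟩
    (1ℤ - sgn (suc n) * T) - + 2 * S₀
      ≈⟨ -‑cong-≋ (-‑congˡ-≋ 1ℤ (*-congˡ-≋ (sgn (suc n)) central)) (*-congˡ-≋ (+ 2) altSum-0-mod) ⟩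
    (1ℤ - sgn (suc n) * - sgn (suc n)) - + 2 * (P * (c₀ - c₁))
      ≡⟨ cong (λ s → (1ℤ - - s * - - s) - + 2 * (P * (c₀ - c₁))) (sgn-even q) ⟩
    (1ℤ - - 1ℤ * - - 1ℤ) - + 2 * (P * (c₀ - c₁))
      ≡⟨ double P (c₀ - c₁) ⟩
    + 2 * (1ℤ - P * (c₀ - c₁)) ∎)
    where
    open ≋-Reasoning (P * P)
    T = trinom (suc n) 0ℤ
    P²-odd : P * P ≡ 1ℤ + + 2 * (+ 2 * + q + + 2 * + q * + q)
    P²-odd = trans (cong (λ x → (1ℤ + x) * (1ℤ + x)) (trans (cong +_ (ℕₚ.*-comm q 2)) (ℤₚ.pos-* 2 q)))
                   (odd-square (+ q))
      where
      odd-square : ∀ q → (1ℤ + + 2 * q) * (1ℤ + + 2 * q) ≡ 1ℤ + + 2 * (+ 2 * q + + 2 * q * q)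
      odd-square = solve-∀
    step : ∀ k → + 2 * trinom k 0ℤ + + 2 * trinom k 1ℤ + 0ℤ * trinom k (+ 2)
               ≡ trinom (suc k) 0ℤ + trinom k 0ℤ
    step k = trans (arrange (trinom k 0ℤ) (trinom k 1ℤ) (trinom k (+ 2)))
                   (cong (λ x → x + trinom k 0ℤ + trinom k 1ℤ + trinom k 0ℤ) (sym (trinom-sym k 1ℤ)))
      where
      arrange : ∀ x y z → + 2 * x + + 2 * y + 0ℤ * z ≡ y + x + y + x
      arrange = solve-∀
    isolate : ∀ a b c → + 2 * b ≡ (+ 2 * a + + 2 * b + 0ℤ * c) - + 2 * a
    isolate = solve-∀
    double : ∀ P h → (1ℤ - - 1ℤ * - - 1ℤ) - + 2 * (P * h) ≡ + 2 * (1ℤ - P * h)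
    double = solve-∀

  altSum-2-mod : S₂ ≋ - + 2 + P * ((c₀ - c₂) + (c₀ - c₁)) [mod P * P ]
  altSum-2-mod = begin
    S₂
      ≡⟨ isolate S₀ S₁ S₂ ⟩
    (1ℤ * S₀ + + 2 * S₁ + 1ℤ * S₂) - S₀ - + 2 * S₁
      ≡⟨ cong (λ x → x - S₀ - + 2 * S₁) (altSum-telescope 1ℤ (+ 2) 1ℤ (λ k → trinom k 1ℤ) step (suc n)) ⟩
    (0ℤ - sgn (suc n) * trinom (suc n) 1ℤ) - S₀ - + 2 * S₁
      ≡⟨ cong₂ (λ s x → (0ℤ - - s * x) - S₀ - + 2 * S₁) (sgn-even q)
               (trans (sym (ℤₚ.*-identityˡ _)) (trinom-deriv n 1ℤ)) ⟩
    (0ℤ - - 1ℤ * (P * (trinom n 0ℤ - trinom n (+ 2)))) - S₀ - + 2 * S₁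
      ≈⟨ -‑cong-≋ (-‑cong-≋ (-‑congˡ-≋ 0ℤ (*-congˡ-≋ (- 1ℤ) scaled-mod)) altSum-0-mod)
                  (*-congˡ-≋ (+ 2) altSum-1-mod) ⟩
    (0ℤ - - 1ℤ * (P * (c₀ - c₂))) - P * (c₀ - c₁) - + 2 * (1ℤ - P * (c₀ - c₁))
      ≡⟨ collect P (c₀ - c₂) (c₀ - c₁) ⟩
    - + 2 + P * ((c₀ - c₂) + (c₀ - c₁)) ∎
    where
    open ≋-Reasoning (P * P)
    scaled-mod : P * (trinom n 0ℤ - trinom n (+ 2)) ≋ P * (c₀ - c₂) [mod P * P ]
    scaled-mod = *-cong-≋-scale P (-‑cong-≋ t₀≋c₀ t₂≋c₂)
    step : ∀ k → 1ℤ * trinom k 0ℤ + + 2 * trinom k 1ℤ + 1ℤ * trinom k (+ 2)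
               ≡ trinom (suc k) 1ℤ + trinom k 1ℤ
    step k = arrange (trinom k 0ℤ) (trinom k 1ℤ) (trinom k (+ 2))
      where
      arrange : ∀ x y z → 1ℤ * x + + 2 * y + 1ℤ * z ≡ x + y + z + y
      arrange = solve-∀
    isolate : ∀ a b c → c ≡ (1ℤ * a + + 2 * b + 1ℤ * c) - a - + 2 * b
    isolate = solve-∀
    collect : ∀ P x y → (0ℤ - - 1ℤ * (P * x)) - P * y - + 2 * (1ℤ - P * y) ≡ - + 2 + P * (x + y)
    collect = solve-∀

theorem1p3 : (p : ℕ) → Prime p → p > 3 →
    (altSum p 0ℤ ≡ + p * ((+ 3 * legendre3 p - 1ℤ) / + 2) [mod + p * + p ])
  × (altSum p 1ℤ ≡ 1ℤ - + p * ((+ 3 * legendre3 p - 1ℤ) / + 2) [mod + p * + p ])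
  × (altSum p (+ 2) ≡ - + 2 + + 3 * + p * legendre3 p [mod + p * + p ])
theorem1p3 p p-prime p>3 with prime⇒odd p-prime (ℕₚ.<-trans (ℕₚ.n<1+n 2) p>3)
... | zero  , refl = contradiction p>3 λ { (s≤s ()) }
... | suc q , refl =
    ≋⇒≡-mod (≋-trans altSum-0-mod (≡⇒≋ (cong (P *_) half)))
  , ≋⇒≡-mod (≋-trans altSum-1-mod (≡⇒≋ (cong (λ h → 1ℤ - P * h) half)))
  , ≋⇒≡-mod (≋-trans altSum-2-mod (≡⇒≋ (triple P (legendre3-recurrence (suc (q ℕ.* 2))))))
  where
  n = suc q ℕ.* 2
  P = + suc n
  3∤p : ¬ 3 ℕ.∣ suc n
  3∤p = prime⇒¬∣ p-prime p>3
  top = trinom-pred-prime≋legendre3 p-prime n {0} refl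
  open AltSumsModPrimeSquare (suc q) (trinom-prime-centre p-prime 3∤p) (proj₁ top) (proj₂ top)
                        (proj₁ (trinom-pred-prime≋legendre3 p-prime (q ℕ.* 2) {2} refl))
  half : legendre3 (suc n) - legendre3 n ≡ (+ 3 * legendre3 (suc n) - 1ℤ) / + 2
  half = legendre3-difference n 3∤p
  triple : ∀ P {x y z} → x ≡ - (y + z) → - + 2 + P * ((x - z) + (x - y)) ≡ - + 2 + + 3 * P * x
  triple P {y = y} {z} refl = solve (P ∷ y ∷ z ∷ [])
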